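{- Let $(H_{\mathbf{k}})$, $\mathbf{k}\in\mathbb{N}^h$, be a strongly polynomial sequence of graphs, each of which is simple except possibly for a single loop on some vertices. Then the sequence obtained by adding a loop to every vertex of $H_{\mathbf{k}}$ that does not yet have one is strongly polynomial in $\mathbf{k}$.
   Context: Graphs are finite; $\mathrm{hom}(G,H)$ counts homomorphisms (a loop at a vertex allows edges of $G$ to be mapped to it). $\mathbb{N}$ denotes the positive integers. A sequence $(H_{\mathbf{k}})$ indexed by all $\mathbf{k}\in\mathbb{N}^h$ is strongly polynomial if for every graph $G$ there is a polynomial $p(G;\mathbf{x})$ with $\mathrm{hom}(G,H_{\mathbf{k}})=p(G;\mathbf{k})$ for all $\mathbf{k}\in\mathbb{N}^h$. -}

module Defs where

open import Data.Nat using (ℕ; zero; suc; _≤_)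
open import Data.Bool using (Bool; true; false; _∨_; _∧_; if_then_else_)
open import Data.Fin using (Fin; _≟_)
open import Data.Fin.Properties using (all?)
open import Data.Vec using (Vec; []; _∷_; lookup)
open import Data.Vec.Relation.Unary.All using (All)
open import Data.List using (List; []; _∷_; map; concatMap; length; filter; foldr)
open import Data.List.Base using (allFin)
open import Data.Product using (_×_; _,_)
open import Data.Integer using (+_)
open import Data.Rational using (ℚ; 0ℚ; 1ℚ; _+_; _*_; _/_)
open import Relation.Nullary.Decidable using (⌊_⌋)
open import Relation.Binary.PropositionalEquality using (_≡_)

-- A finite graph with vertex set Fin size, adjacency given as a Boolean
-- relation (loops allowed: adj v v = true means a loop at v; at most one
-- loop / edge between any two vertices, i.e. "simple except possibly a
-- single loop on some vertices").
record Graph : Set where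
  field
    size : ℕ
    adj  : Fin size → Fin size → Bool
    adj-sym : ∀ u v → adj u v ≡ adj v u
open Graph public

allMaps : (m n : ℕ) → List (Vec (Fin n) m)
allMaps zero    n = [] ∷ []
allMaps (suc m) n = concatMap (λ i → map (i ∷_) (allMaps m n)) (allFin n)

IsHom : (G H : Graph) → Vec (Fin (size H)) (size G) → Set
IsHom G H f = ∀ u v → adj G u v ≡ true → adj H (lookup f u) (lookup f v) ≡ true

isHom? : (G H : Graph) → Vec (Fin (size H)) (size G) → Bool
isHom? G H f = ⌊ all? (λ u → all? (λ v →
  Data.Bool._≟_ (if adj G u v then adj H (lookup f u) (lookup f v) else true) true)) ⌋

hom : Graph → Graph → ℕ
hom G H = length (filter (λ f → Data.Bool._≟_ (isHom? G H f) true) (allMaps (size G) (size H)))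

-- multivariate polynomials in h variables with rational coefficients,
-- given as a finite list of monomials (coefficient, exponent vector)
Poly : ℕ → Set
Poly h = List (ℚ × Vec ℕ h)

_^ℚ_ : ℚ → ℕ → ℚ
q ^ℚ zero  = 1ℚ
q ^ℚ suc n = q * (q ^ℚ n)

monoEval : ∀ {h} → Vec ℕ h → Vec ℕ h → ℚ
monoEval []       []       = 1ℚ
monoEval (k ∷ ks) (e ∷ es) = (((+ k) / 1) ^ℚ e) * monoEval ks es

evalPoly : ∀ {h} → Poly h → Vec ℕ h → ℚ
evalPoly p k = foldr (λ { (c , e) acc → c * monoEval k e + acc }) 0ℚ p

-- k ∈ ℕ^h with ℕ the positive integers
Positive : ∀ {h} → Vec ℕ h → Set
Positive k = All (1 ≤_) k

toℚ : ℕ → ℚ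
toℚ n = (+ n) / 1

StronglyPolynomial : (h : ℕ) → (Vec ℕ h → Graph) → Set
StronglyPolynomial h H =
  ∀ (G : Graph) → Data.Product.Σ (Poly h) λ p →
    ∀ (k : Vec ℕ h) → Positive k → toℚ (hom G (H k)) ≡ evalPoly p k

addLoops : Graph → Graph
addLoops H = record
  { size = size H
  ; adj  = λ u v → adj H u v ∨ ⌊ u ≟ v ⌋
  ; adj-sym = λ u v → symHelper u v
  }
  where
  open import Relation.Binary.PropositionalEquality using (cong₂; sym; refl)
  open import Relation.Nullary using (yes; no)
  swapDec : ∀ (u v : Fin (size H)) → ⌊ u ≟ v ⌋ ≡ ⌊ v ≟ u ⌋
  swapDec u v with u ≟ v | v ≟ u
  ... | yes _ | yes _ = refl
  ... | no _  | no _  = refl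
  ... | yes p | no q  = Data.Empty.⊥-elim (q (sym p)) where import Data.Empty
  ... | no p  | yes q = Data.Empty.⊥-elim (p (sym q)) where import Data.Empty
  symHelper : ∀ u v → (adj H u v ∨ ⌊ u ≟ v ⌋) ≡ (adj H v u ∨ ⌊ v ≟ u ⌋)
  symHelper u v = cong₂ _∨_ (Graph.adj-sym H u v) (swapDec u v)

-- A map f from G to H is a homomorphism into H° exactly when every edge uv of G is
-- either sent to an edge of H or collapsed (f u = f v).  Count the maps that send a
-- list A of vertex pairs to edges of H and a list B to edges of H°.  Inclusion–exclusion
-- on the first pair uv of B gives
--   N(A, uv ∷ B) + N((uv ∷ A)/uv, B/uv) = N(uv ∷ A, B) + N(A/uv, B/uv),
-- where /uv identifies v with u (a pair with u = v is simply dropped from B).  So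
-- N(A, uv ∷ B) is a signed sum of three counts with shorter B.  When B is empty,
-- N(A, []) = hom(G_A, H) for the graph G_A with edge list A, which is polynomial in k by
-- hypothesis, and polynomials are closed under + and −.
module Submission where

open import Defs

import Algebra.Properties.CommutativeMonoid.Sum as MonoidSum
open import Data.Bool as Bool using (Bool; true; false; T; _∧_; _∨_; if_then_else_)
open import Data.Bool.ListAction using (all)
open import Data.Bool.Properties using (T-≡; T-∨; ∧-identityʳ; ∨-zeroʳ; ∨-comm)
open import Data.Empty using (⊥-elim)
open import Data.Fin as Fin using (Fin; punchOut; _≟_)
open import Data.Fin.Properties using (punchIn-punchOut)
import Data.Integer as ℤ
import Data.Integer.Properties as ℤ
open import Data.List
  using (List; []; _∷_; _++_; map; length; filter; concatMap; tabulate; allFin; cartesianProduct)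
open import Data.List.Properties using (filter-++; length-++; length-map)
open import Data.List.Membership.Propositional using (_∈_)
open import Data.List.Membership.Propositional.Properties
  using (∈-filter⁺; ∈-filter⁻; ∈-cartesianProduct⁺; ∈-allFin)
import Data.List.Membership.DecPropositional as DecMembership
open import Data.List.Relation.Unary.All as All using (All)
open import Data.List.Relation.Unary.All.Properties using (all⁺; all⁻)
open import Data.Nat using (ℕ; zero; suc; _+_)
import Data.Nat.Coprimality as Coprime
import Data.Nat.Properties as ℕ
open import Data.Product as Prod using (_×_; _,_; proj₁; proj₂; uncurry)
open import Data.Product.Properties using (≡-dec)
open import Data.Rational as ℚ using (ℚ; mkℚ; -_; 0ℚ)
import Data.Rational.Properties as ℚ
open import Data.Sum as Sum using (_⊎_; inj₁; inj₂)
open import Data.Vec using (Vec; []; _∷_; lookup; insertAt)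
open import Data.Vec.Properties using (insertAt-lookup; insertAt-punchIn)
open import Function using (_∘_; id; Equivalence)
open import Relation.Binary.PropositionalEquality
open import Relation.Nullary using (Dec; yes; no)
open import Relation.Nullary.Decidable using (⌊_⌋; T?; toWitness; fromWitness; isYes≗does; dec-true)

open MonoidSum ℕ.+-0-commutativeMonoid
  using (sum-syntax; ∑-comm; ∑-distrib-+; sum-cong-≗; sum-replicate-zero)
open ≡-Reasoning

-- Counting as a sum over all maps

ind : Bool → ℕ
ind b = if b then 1 else 0

count : ∀ {X : Set} → (X → Bool) → List X → ℕ
count P xs = length (filter (λ x → P x Bool.≟ true) xs)

count-++ : ∀ {X : Set} (P : X → Bool) xs ys → count P (xs ++ ys) ≡ count P xs + count P ys
count-++ P xs ys = trans (cong length (filter-++ _ xs ys)) (length-++ (filter _ xs))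

count-map : ∀ {X Y : Set} (P : Y → Bool) (f : X → Y) xs → count P (map f xs) ≡ count (P ∘ f) xs
count-map P f [] = refl
count-map P f (x ∷ xs) with P (f x)
... | true  = cong suc (count-map P f xs)
... | false = count-map P f xs

count-concatMap-tabulate : ∀ {X Y : Set} {n} (P : Y → Bool) (g : X → List Y) (h : Fin n → X) →
  count P (concatMap g (tabulate h)) ≡ ∑[ i < n ] count P (g (h i))
count-concatMap-tabulate {n = zero}  P g h = refl
count-concatMap-tabulate {n = suc n} P g h =
  trans (count-++ P (g (h Fin.zero)) _)
        (cong (count P (g (h Fin.zero)) +_) (count-concatMap-tabulate P g (h ∘ Fin.suc)))

∑-maps : ∀ m {n} → (Vec (Fin n) m → ℕ) → ℕ
∑-maps zero        F = F []
∑-maps (suc m) {n} F = ∑[ i < n ] ∑-maps m (λ f → F (i ∷ f))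

count-allMaps : ∀ m {n} (P : Vec (Fin n) m → Bool) → count P (allMaps m n) ≡ ∑-maps m (ind ∘ P)
count-allMaps zero P with P []
... | true  = refl
... | false = refl
count-allMaps (suc m) {n} P = begin
  count P (concatMap (λ i → map (i ∷_) (allMaps m n)) (allFin n))
    ≡⟨ count-concatMap-tabulate P (λ i → map (i ∷_) (allMaps m n)) id ⟩
  ∑[ i < n ] count P (map (i ∷_) (allMaps m n))
    ≡⟨ sum-cong-≗ (λ i → trans (count-map P (i ∷_) (allMaps m n)) (count-allMaps m (P ∘ (i ∷_)))) ⟩
  ∑[ i < n ] ∑-maps m (λ f → ind (P (i ∷ f)))
    ∎

∑-maps-cong : ∀ m {n} {F G : Vec (Fin n) m → ℕ} → (∀ f → F f ≡ G f) → ∑-maps m F ≡ ∑-maps m G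
∑-maps-cong zero    F≗G = F≗G []
∑-maps-cong (suc m) F≗G = sum-cong-≗ (λ i → ∑-maps-cong m (F≗G ∘ (i ∷_)))

∑-maps-distrib-+ : ∀ m {n} (F G : Vec (Fin n) m → ℕ) →
  ∑-maps m (λ f → F f + G f) ≡ ∑-maps m F + ∑-maps m G
∑-maps-distrib-+ zero    F G = refl
∑-maps-distrib-+ (suc m) F G =
  trans (sum-cong-≗ (λ i → ∑-maps-distrib-+ m (F ∘ (i ∷_)) (G ∘ (i ∷_))))
        (∑-distrib-+ (λ i → ∑-maps m (F ∘ (i ∷_))) (λ i → ∑-maps m (G ∘ (i ∷_))))

∑-∑-maps-comm : ∀ m {n k} (F : Fin k → Vec (Fin n) m → ℕ) →
  ∑[ i < k ] ∑-maps m (F i) ≡ ∑-maps m (λ f → ∑[ i < k ] F i f)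
∑-∑-maps-comm zero    F = refl
∑-∑-maps-comm (suc m) F =
  trans (∑-comm (λ i j → ∑-maps m (λ f → F i (j ∷ f))))
        (sum-cong-≗ (λ j → ∑-∑-maps-comm m (λ i f → F i (j ∷ f))))

∑-maps-insertAt : ∀ m {n} (v : Fin (suc m)) (F : Vec (Fin n) (suc m) → ℕ) →
  ∑-maps (suc m) F ≡ ∑[ i < n ] ∑-maps m (λ g → F (insertAt g v i))
∑-maps-insertAt m       Fin.zero    F = refl
∑-maps-insertAt (suc m) (Fin.suc v) F = begin
  ∑[ j < _ ] ∑-maps (suc m) (λ f → F (j ∷ f))
    ≡⟨ sum-cong-≗ (λ j → ∑-maps-insertAt m v (F ∘ (j ∷_))) ⟩
  ∑[ j < _ ] ∑[ i < _ ] ∑-maps m (λ g → F (j ∷ insertAt g v i))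
    ≡⟨ ∑-comm (λ j i → ∑-maps m (λ g → F (j ∷ insertAt g v i))) ⟩
  ∑[ i < _ ] ∑[ j < _ ] ∑-maps m (λ g → F (j ∷ insertAt g v i))
    ∎

-- Identifying two vertices

⌊suc≟suc⌋ : ∀ {n} (a b : Fin n) → ⌊ Fin.suc a ≟ Fin.suc b ⌋ ≡ ⌊ a ≟ b ⌋
⌊suc≟suc⌋ a b with a ≟ b
... | yes _ = refl
... | no  _ = refl

⌊≟⌋-refl : ∀ {n} (a : Fin n) → ⌊ a ≟ a ⌋ ≡ true
⌊≟⌋-refl a = trans (isYes≗does (a ≟ a)) (dec-true (a ≟ a) refl)

∑-δ : ∀ {n} (a : Fin n) (G : Fin n → ℕ) → ∑[ i < n ] (if ⌊ a ≟ i ⌋ then G i else 0) ≡ G a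
∑-δ {suc n} Fin.zero    G = trans (cong (G Fin.zero +_) (sum-replicate-zero n)) (ℕ.+-identityʳ _)
∑-δ {suc n} (Fin.suc a) G =
  trans (sum-cong-≗ (λ i → cong (λ b → if b then G (Fin.suc i) else 0) (⌊suc≟suc⌋ a i)))
        (∑-δ a (G ∘ Fin.suc))

lookup-insertAt-≢ : ∀ {A : Set} {m} (g : Vec A m) {v w : Fin (suc m)} (v≢w : v ≢ w) x →
  lookup (insertAt g v x) w ≡ lookup g (punchOut v≢w)
lookup-insertAt-≢ g {v} v≢w x =
  trans (cong (lookup (insertAt g v x)) (sym (punchIn-punchOut v≢w)))
        (insertAt-punchIn g v x (punchOut v≢w))

-- The maps f with f u = f v are exactly the maps merge g; contract is the induced
-- quotient map on vertices.
module Contraction {m} {v u : Fin (suc m)} (v≢u : v ≢ u) where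

  contract : Fin (suc m) → Fin m
  contract w with v ≟ w
  ... | yes _   = punchOut v≢u
  ... | no v≢w = punchOut v≢w

  merge : ∀ {A : Set} → Vec A m → Vec A (suc m)
  merge g = insertAt g v (lookup g (punchOut v≢u))

  lookup-merge : ∀ {A : Set} (g : Vec A m) w → lookup (merge g) w ≡ lookup g (contract w)
  lookup-merge g w with v ≟ w
  ... | yes refl = insertAt-lookup g v _
  ... | no v≢w  = lookup-insertAt-≢ g v≢w _

  ∑-maps-merge : ∀ {n} (F : Vec (Fin n) (suc m) → ℕ) →
    ∑-maps (suc m) (λ f → if ⌊ lookup f u ≟ lookup f v ⌋ then F f else 0) ≡ ∑-maps m (F ∘ merge)
  ∑-maps-merge {n} F = begin
    ∑-maps (suc m) (λ f → if ⌊ lookup f u ≟ lookup f v ⌋ then F f else 0)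
      ≡⟨ ∑-maps-insertAt m v (λ f → if ⌊ lookup f u ≟ lookup f v ⌋ then F f else 0) ⟩
    ∑[ i < n ] ∑-maps m (λ g →
      if ⌊ lookup (insertAt g v i) u ≟ lookup (insertAt g v i) v ⌋ then F (insertAt g v i) else 0)
      ≡⟨ sum-cong-≗ (λ i → ∑-maps-cong m (λ g →
           cong₂ (λ a b → if ⌊ a ≟ b ⌋ then F (insertAt g v i) else 0)
                 (lookup-insertAt-≢ g v≢u i) (insertAt-lookup g v i))) ⟩
    ∑[ i < n ] ∑-maps m (λ g → if ⌊ lookup g (punchOut v≢u) ≟ i ⌋ then F (insertAt g v i) else 0)
      ≡⟨ ∑-∑-maps-comm m (λ i g →
           if ⌊ lookup g (punchOut v≢u) ≟ i ⌋ then F (insertAt g v i) else 0) ⟩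
    ∑-maps m (λ g →
      ∑[ i < n ] (if ⌊ lookup g (punchOut v≢u) ≟ i ⌋ then F (insertAt g v i) else 0))
      ≡⟨ ∑-maps-cong m (λ g → ∑-δ (lookup g (punchOut v≢u)) (F ∘ insertAt g v)) ⟩
    ∑-maps m (F ∘ merge)
      ∎

Pair : ℕ → Set
Pair m = Fin m × Fin m

preserves : ∀ {m n} → (Fin n → Fin n → Bool) → List (Pair m) → Vec (Fin n) m → Bool
preserves R ps f = all (uncurry λ u v → R (lookup f u) (lookup f v)) ps

relabel : ∀ {m m′} → (Fin m → Fin m′) → List (Pair m) → List (Pair m′)
relabel σ = map (λ uv → σ (proj₁ uv) , σ (proj₂ uv))

preserves-relabel : ∀ {m m′ n} (R : Fin n → Fin n → Bool) (σ : Fin m → Fin m′)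
  {f : Vec (Fin n) m} {g : Vec (Fin n) m′} → (∀ w → lookup f w ≡ lookup g (σ w)) →
  ∀ ps → preserves R ps f ≡ preserves R (relabel σ ps) g
preserves-relabel R σ f≗g∘σ []            = refl
preserves-relabel R σ {f} {g} f≗g∘σ ((a , b) ∷ ps) =
  cong₂ _∧_ (cong₂ R (f≗g∘σ a) (f≗g∘σ b)) (preserves-relabel R σ {f} {g} f≗g∘σ ps)

T-injective : ∀ {a b} → (T a → T b) → (T b → T a) → a ≡ b
T-injective {false} {false} _ _ = refl
T-injective {false} {true}  _ b⇒a = ⊥-elim (b⇒a _)
T-injective {true}  {false} a⇒b _ = ⊥-elim (a⇒b _)
T-injective {true}  {true}  _ _ = refl

record Presents (G : Graph) (ps : List (Pair (size G))) : Set where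
  field
    pair⇒edge : ∀ {u v} → (u , v) ∈ ps → T (adj G u v)
    edge⇒pair : ∀ {u v} → T (adj G u v) → (u , v) ∈ ps ⊎ (v , u) ∈ ps

module _ (G H : Graph) (f : Vec (Fin (size H)) (size G)) where

  isHom?-sound : T (isHom? G H f) → IsHom G H f
  isHom?-sound t u v e = if-true (adj G u v) e (toWitness t u v)
    where
    if-true : ∀ b {x} → b ≡ true → (if b then x else true) ≡ true → x ≡ true
    if-true true refl x≡true = x≡true

  isHom?-complete : IsHom G H f → T (isHom? G H f)
  isHom?-complete hom = fromWitness λ u v → by-cases u v
    where
    by-cases : ∀ u v → (if adj G u v then adj H (lookup f u) (lookup f v) else true) ≡ true
    by-cases u v with adj G u v in e
    ... | true  = hom u v e
    ... | false = refl

  isHom?≡preserves : ∀ {ps} → Presents G ps → isHom? G H f ≡ preserves (adj H) ps f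
  isHom?≡preserves {ps} presents = T-injective sound complete
    where
    open Presents presents
    T⇒≡ : ∀ {b} → T b → b ≡ true
    T⇒≡ = Equivalence.to T-≡
    sound : T (isHom? G H f) → T (preserves (adj H) ps f)
    sound t = all⁻ (uncurry λ u v → adj H (lookup f u) (lookup f v))
      (All.tabulate λ {(u , v)} uv∈ps →
        Equivalence.from T-≡ (isHom?-sound t u v (T⇒≡ (pair⇒edge uv∈ps))))
    complete : T (preserves (adj H) ps f) → T (isHom? G H f)
    complete t = isHom?-complete λ u v e → oriented (edge⇒pair (Equivalence.from T-≡ e))
      where
      images : All (λ (u , v) → T (adj H (lookup f u) (lookup f v))) ps
      images = all⁺ (uncurry λ u v → adj H (lookup f u) (lookup f v)) ps t
      oriented : ∀ {u v} → (u , v) ∈ ps ⊎ (v , u) ∈ ps → adj H (lookup f u) (lookup f v) ≡ true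
      oriented (inj₁ uv∈ps) = T⇒≡ (All.lookup images uv∈ps)
      oriented (inj₂ vu∈ps) = trans (adj-sym H _ _) (T⇒≡ (All.lookup images vu∈ps))

hom-presented : ∀ {G ps} → Presents G ps → ∀ H →
  hom G H ≡ ∑-maps (size G) (λ f → ind (preserves (adj H) ps f))
hom-presented {G} presents H =
  trans (count-allMaps (size G) (isHom? G H))
        (∑-maps-cong (size G) (λ f → cong ind (isHom?≡preserves G H f presents)))

edges : (G : Graph) → List (Pair (size G))
edges G = filter (T? ∘ uncurry (adj G)) (cartesianProduct (allFin (size G)) (allFin (size G)))

edges-presents : ∀ G → Presents G (edges G)
edges-presents G = record
  { pair⇒edge = λ uv∈ps → proj₂ (∈-filter⁻ (T? ∘ uncurry (adj G)) {xs = allPairs} uv∈ps)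
  ; edge⇒pair = λ {u} {v} e →
      inj₁ (∈-filter⁺ (T? ∘ uncurry (adj G)) (∈-cartesianProduct⁺ (∈-allFin u) (∈-allFin v)) e)
  }
  where
  allPairs : List (Pair (size G))
  allPairs = cartesianProduct (allFin (size G)) (allFin (size G))

module _ {m : ℕ} where
  open DecMembership (≡-dec (_≟_ {m}) (_≟_ {m})) using (_∈?_)

  graphOf : List (Pair m) → Graph
  graphOf ps = record
    { size    = m
    ; adj     = λ u v → ⌊ (u , v) ∈? ps ⌋ ∨ ⌊ (v , u) ∈? ps ⌋
    ; adj-sym = λ u v → ∨-comm ⌊ (u , v) ∈? ps ⌋ ⌊ (v , u) ∈? ps ⌋
    }

  graphOf-presents : ∀ ps → Presents (graphOf ps) ps
  graphOf-presents ps = record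
    { pair⇒edge = λ {u} {v} uv∈ps →
        Equivalence.from (T-∨ {⌊ (u , v) ∈? ps ⌋}) (inj₁ (fromWitness uv∈ps))
    ; edge⇒pair = λ {u} {v} e →
        Sum.map toWitness toWitness (Equivalence.to (T-∨ {⌊ (u , v) ∈? ps ⌋}) e)
    }

-- Maps sending one edge list into H and another into H°

isMixedHom : ∀ {m} (A B : List (Pair m)) (H : Graph) → Vec (Fin (size H)) m → Bool
isMixedHom A B H f = preserves (adj (addLoops H)) B f ∧ preserves (adj H) A f

mixedHom : ∀ {m} → List (Pair m) → List (Pair m) → Graph → ℕ
mixedHom {m} A B H = ∑-maps m (ind ∘ isMixedHom A B H)

hom-graphOf : ∀ {m} (A : List (Pair m)) H → hom (graphOf A) H ≡ mixedHom A [] H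
hom-graphOf A = hom-presented (graphOf-presents A)

hom-addLoops : ∀ G H → hom G (addLoops H) ≡ mixedHom [] (edges G) H
hom-addLoops G H = trans (hom-presented (edges-presents G) (addLoops H))
  (∑-maps-cong (size G) (λ f → cong ind (sym (∧-identityʳ _))))

mixedHom-loop : ∀ {m} {u v : Fin m} → v ≡ u → ∀ A B H → mixedHom A ((u , v) ∷ B) H ≡ mixedHom A B H
mixedHom-loop {m} {u} refl A B H = ∑-maps-cong m λ f →
  cong (λ b → ind ((b ∧ preserves (adj (addLoops H)) B f) ∧ preserves (adj H) A f))
       (trans (cong (adj H (lookup f u) (lookup f u) ∨_) (⌊≟⌋-refl (lookup f u))) (∨-zeroʳ _))

-- With x = [f u = f v] and y = [f u f v ∈ E(H)], the pair uv goes to an edge of H°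
-- iff y ∨ x, and [y ∨ x] + [x ∧ y] = [y] + [x].
inclusion-exclusion : ∀ x y b a →
  ind (((y ∨ x) ∧ b) ∧ a) + (if x then ind (b ∧ (y ∧ a)) else 0)
    ≡ ind (b ∧ (y ∧ a)) + (if x then ind (b ∧ a) else 0)
inclusion-exclusion x     true  b     a = refl
inclusion-exclusion true  false b     a = ℕ.+-comm (ind (b ∧ a)) (ind (b ∧ false))
inclusion-exclusion false false true  a = refl
inclusion-exclusion false false false a = refl

module _ {m} {v u : Fin (suc m)} (v≢u : v ≢ u) (H : Graph) where
  open Contraction v≢u

  mixedHom-contract : ∀ A B → mixedHom (relabel contract A) (relabel contract B) H
    ≡ ∑-maps (suc m) (λ f → if ⌊ lookup f u ≟ lookup f v ⌋ then ind (isMixedHom A B H f) else 0)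
  mixedHom-contract A B = sym (trans (∑-maps-merge (ind ∘ isMixedHom A B H)) (∑-maps-cong m λ g →
    cong ind (cong₂ _∧_ (relabelled (adj (addLoops H)) B g) (relabelled (adj H) A g))))
    where
    relabelled : ∀ R ps g → preserves R ps (merge g) ≡ preserves R (relabel contract ps) g
    relabelled R ps g = preserves-relabel R contract {merge g} {g} (lookup-merge g) ps

  mixedHom-split : ∀ A B →
    mixedHom A ((u , v) ∷ B) H + mixedHom (relabel contract ((u , v) ∷ A)) (relabel contract B) H
      ≡ mixedHom ((u , v) ∷ A) B H + mixedHom (relabel contract A) (relabel contract B) H
  mixedHom-split A B = begin
    mixedHom A ((u , v) ∷ B) H + mixedHom (relabel contract ((u , v) ∷ A)) (relabel contract B) H
      ≡⟨ cong (mixedHom A ((u , v) ∷ B) H +_) (mixedHom-contract ((u , v) ∷ A) B) ⟩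
    ∑-maps (suc m) T₁ + ∑-maps (suc m) T₂
      ≡⟨ sym (∑-maps-distrib-+ (suc m) T₁ T₂) ⟩
    ∑-maps (suc m) (λ f → T₁ f + T₂ f)
      ≡⟨ ∑-maps-cong (suc m) (λ f → inclusion-exclusion (x f) (y f) (b f) (a f)) ⟩
    ∑-maps (suc m) (λ f → T₃ f + T₄ f)
      ≡⟨ ∑-maps-distrib-+ (suc m) T₃ T₄ ⟩
    ∑-maps (suc m) T₃ + ∑-maps (suc m) T₄
      ≡⟨ cong (mixedHom ((u , v) ∷ A) B H +_) (sym (mixedHom-contract A B)) ⟩
    mixedHom ((u , v) ∷ A) B H + mixedHom (relabel contract A) (relabel contract B) H
      ∎
    where
    x y b a : Vec (Fin (size H)) (suc m) → Bool
    x f = ⌊ lookup f u ≟ lookup f v ⌋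
    y f = adj H (lookup f u) (lookup f v)
    b = preserves (adj (addLoops H)) B
    a = preserves (adj H) A
    T₁ T₂ T₃ T₄ : Vec (Fin (size H)) (suc m) → ℕ
    T₁ f = ind (((y f ∨ x f) ∧ b f) ∧ a f)
    T₂ f = if x f then ind (b f ∧ (y f ∧ a f)) else 0
    T₃ f = ind (b f ∧ (y f ∧ a f))
    T₄ f = if x f then ind (b f ∧ a f) else 0

-- Polynomial functions of k

-- A record rather than the Σ-type of StronglyPolynomial, so that g is determined by
-- unification (toℚ is not injective on normal forms).
record IsPolynomial (h : ℕ) (g : Vec ℕ h → ℕ) : Set where
  constructor mkIsPolynomial
  field
    poly      : Poly h
    poly-eval : ∀ k → Positive k → toℚ (g k) ≡ evalPoly poly k

toℚ-+ : ∀ a b → toℚ (a + b) ≡ toℚ a ℚ.+ toℚ b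
toℚ-+ a b = begin
  toℚ (a + b)
    ≡⟨ cong (ℚ._/ 1) (sym (cong₂ ℤ._+_ (ℤ.*-identityʳ (ℤ.+ a)) (ℤ.*-identityʳ (ℤ.+ b)))) ⟩
  (ℤ.+ a ℤ.* ℤ.+ 1 ℤ.+ ℤ.+ b ℤ.* ℤ.+ 1) ℚ./ 1
    ≡⟨⟩
  integral a ℚ.+ integral b
    ≡⟨ sym (cong₂ ℚ._+_ (toℚ-integral a) (toℚ-integral b)) ⟩
  toℚ a ℚ.+ toℚ b
    ∎
  where
  integral : ℕ → ℚ
  integral a = mkℚ (ℤ.+ a) 0 (Coprime.sym (Coprime.1-coprimeTo a))
  toℚ-integral : ∀ a → toℚ a ≡ integral a
  toℚ-integral a = ℚ.↥p/↧p≡p (integral a)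

evalPoly-++ : ∀ {h} (p q : Poly h) k → evalPoly (p ++ q) k ≡ evalPoly p k ℚ.+ evalPoly q k
evalPoly-++ []            q k = sym (ℚ.+-identityˡ (evalPoly q k))
evalPoly-++ ((c , e) ∷ p) q k =
  trans (cong (c ℚ.* monoEval k e ℚ.+_) (evalPoly-++ p q k))
        (sym (ℚ.+-assoc (c ℚ.* monoEval k e) (evalPoly p k) (evalPoly q k)))

negatePoly : ∀ {h} → Poly h → Poly h
negatePoly = map (Prod.map₁ -_)

evalPoly-negate : ∀ {h} (p : Poly h) k → evalPoly (negatePoly p) k ≡ - evalPoly p k
evalPoly-negate []            k = refl
evalPoly-negate ((c , e) ∷ p) k =
  trans (cong₂ ℚ._+_ (sym (ℚ.neg-distribˡ-* c (monoEval k e))) (evalPoly-negate p k))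
        (sym (ℚ.neg-distrib-+ (c ℚ.* monoEval k e) (evalPoly p k)))

module _ {h : ℕ} where

  IsPolynomial-cong : ∀ {f g : Vec ℕ h → ℕ} →
    (∀ k → f k ≡ g k) → IsPolynomial h f → IsPolynomial h g
  IsPolynomial-cong f≗g (mkIsPolynomial p f≡p) =
    mkIsPolynomial p λ k k⁺ → trans (cong toℚ (sym (f≗g k))) (f≡p k k⁺)

  IsPolynomial-+ : ∀ {f g : Vec ℕ h → ℕ} →
    IsPolynomial h f → IsPolynomial h g → IsPolynomial h (λ k → f k + g k)
  IsPolynomial-+ {f} {g} (mkIsPolynomial p f≡p) (mkIsPolynomial q g≡q) =
    mkIsPolynomial (p ++ q) λ k k⁺ → begin
      toℚ (f k + g k)               ≡⟨ toℚ-+ (f k) (g k) ⟩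
      toℚ (f k) ℚ.+ toℚ (g k)       ≡⟨ cong₂ ℚ._+_ (f≡p k k⁺) (g≡q k k⁺) ⟩
      evalPoly p k ℚ.+ evalPoly q k ≡⟨ sym (evalPoly-++ p q k) ⟩
      evalPoly (p ++ q) k           ∎

  IsPolynomial-cancelʳ : ∀ {f g : Vec ℕ h → ℕ} →
    IsPolynomial h (λ k → f k + g k) → IsPolynomial h g → IsPolynomial h f
  IsPolynomial-cancelʳ {f} {g} (mkIsPolynomial p f+g≡p) (mkIsPolynomial q g≡q) =
    mkIsPolynomial (p ++ negatePoly q) λ k k⁺ → let a = toℚ (f k); b = toℚ (g k) in begin
      a                                          ≡⟨ sym (ℚ.+-identityʳ a) ⟩
      a ℚ.+ 0ℚ                                   ≡⟨ cong (a ℚ.+_) (sym (ℚ.+-inverseʳ b)) ⟩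
      a ℚ.+ (b ℚ.- b)                            ≡⟨ sym (ℚ.+-assoc a b (- b)) ⟩
      (a ℚ.+ b) ℚ.- b                            ≡⟨ cong (ℚ._- b) (sym (toℚ-+ (f k) (g k))) ⟩
      toℚ (f k + g k) ℚ.- b                      ≡⟨ cong₂ ℚ._-_ (f+g≡p k k⁺) (g≡q k k⁺) ⟩
      evalPoly p k ℚ.- evalPoly q k              ≡⟨ cong (evalPoly p k ℚ.+_) (sym (evalPoly-negate q k)) ⟩
      evalPoly p k ℚ.+ evalPoly (negatePoly q) k ≡⟨ sym (evalPoly-++ p (negatePoly q) k) ⟩
      evalPoly (p ++ negatePoly q) k             ∎

module _ {h : ℕ} (H : Vec ℕ h → Graph) (H-poly : StronglyPolynomial h H) where

  -- Induction on the length of B: relabelling B does not give a structural subterm.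
  mixedHom-polynomial : ∀ n {m} (A B : List (Pair m)) → length B ≡ n →
    IsPolynomial h (λ k → mixedHom A B (H k))
  mixedHom-polynomial _ A [] _ =
    IsPolynomial-cong (λ k → hom-graphOf A (H k)) (uncurry mkIsPolynomial (H-poly (graphOf A)))
  mixedHom-polynomial zero A (_ ∷ _) ()
  mixedHom-polynomial (suc n) {zero} A (((() , _)) ∷ B) _
  mixedHom-polynomial (suc n) {suc m} A ((u , v) ∷ B) |B|+1≡n+1 = by-cases (v ≟ u)
    where
    |B|≡n : length B ≡ n
    |B|≡n = ℕ.suc-injective |B|+1≡n+1

    by-cases : Dec (v ≡ u) → IsPolynomial h (λ k → mixedHom A ((u , v) ∷ B) (H k))
    by-cases (yes v≡u) = IsPolynomial-cong (λ k → sym (mixedHom-loop v≡u A B (H k)))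
                           (mixedHom-polynomial n A B |B|≡n)
    by-cases (no v≢u) = IsPolynomial-cancelʳ
        (IsPolynomial-cong (λ k → sym (mixedHom-split v≢u (H k) A B))
           (IsPolynomial-+
              (mixedHom-polynomial n ((u , v) ∷ A) B |B|≡n)
              (mixedHom-polynomial n σA σB |σB|≡n)))
        (mixedHom-polynomial n σ[uv∷A] σB |σB|≡n)
      where
      open Contraction v≢u
      σA σ[uv∷A] σB : List (Pair m)
      σA = relabel contract A
      σ[uv∷A] = relabel contract ((u , v) ∷ A)
      σB = relabel contract B
      |σB|≡n : length σB ≡ n
      |σB|≡n = trans (length-map _ B) |B|≡n

corollary3p2 : (h : ℕ) (H : Vec ℕ h → Graph) →
    StronglyPolynomial h H →
    StronglyPolynomial h (λ k → addLoops (H k))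
corollary3p2 h H H-poly G = poly , poly-eval
  where
  open IsPolynomial (IsPolynomial-cong (λ k → sym (hom-addLoops G (H k)))
                      (mixedHom-polynomial H H-poly _ [] (edges G) refl))
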